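{- Let $G=(V,E)$ be a finite graph on $n=|V|$ vertices. Then $v(G)\le\overline v(G)+n+e(G)$, and equality holds if and only if $G$ is a disjoint union of isolated vertices and single edges (copies of $K_2$).
   Context: $v(G)$ is the linear intersection number: the minimum number of points of a linear hypergraph (finite point set, lines are subsets of size $\ge2$, two distinct points in at most one line) whose intersection graph (vertices = lines, adjacent iff distinct and intersecting) is isomorphic to $G$; equivalently the minimum $r$ such that there is a list $C_1,\dots,C_r$ of cliques of $G$ with each edge in exactly one $C_i$ and each vertex in at least two $C_i$. $\overline v(G)$ is the minimum $r$ such that there are cliques $C_1,\dots,C_r$ of $G$, each of size $\ge2$, with each edge in exactly one $C_i$. $e(G)$ is the number of isolated vertices. -}

module Defs where

open import Data.Nat using (ℕ; zero; suc; _+_; _≤_)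
open import Data.Bool using (Bool; true; false)
open import Data.Fin using (Fin)
open import Data.Fin.Subset using (Subset; _∈_; ∣_∣)
open import Data.Vec using (Vec; lookup)
open import Data.List using (List; length; filter; allFin)
open import Data.Product using (Σ; _×_; ∃; ∃-syntax)
open import Data.Sum using (_⊎_)
open import Relation.Nullary using (¬_)
open import Relation.Binary.PropositionalEquality using (_≡_)
open import Relation.Nullary.Decidable using (¬?)
open import Data.List.Relation.Unary.Any using (any?)
open import Data.Bool using (T)
open import Data.Bool.Properties using (T?)

record Graph (n : ℕ) : Set where
  field
    adj    : Fin n → Fin n → Bool
    sym    : ∀ u v → adj u v ≡ adj v u
    irrefl : ∀ u → adj u u ≡ false
open Graph public

Adj : ∀ {n} → Graph n → Fin n → Fin n → Set
Adj G u v = adj G u v ≡ true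

IsClique : ∀ {n} → Graph n → Subset n → Set
IsClique G C = ∀ u v → u ∈ C → v ∈ C → ¬ (u ≡ v) → Adj G u v

EdgeCliquePartition : ∀ {n r} → Graph n → Vec (Subset n) r → Set
EdgeCliquePartition {n} {r} G Cs =
  (∀ i → IsClique G (lookup Cs i)) ×
  (∀ u v → Adj G u v →
     Σ (Fin r) λ i → (u ∈ lookup Cs i × v ∈ lookup Cs i) ×
       (∀ j → u ∈ lookup Cs j → v ∈ lookup Cs j → j ≡ i))

-- list witnessing v(G) ≤ r: additionally every vertex lies in at least two C_i
VCover : ∀ {n} → Graph n → ℕ → Set
VCover {n} G r = Σ (Vec (Subset n) r) λ Cs → EdgeCliquePartition G Cs ×
  (∀ u → Σ (Fin r) λ i → Σ (Fin r) λ j →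
     ¬ (i ≡ j) × u ∈ lookup Cs i × u ∈ lookup Cs j)

-- list witnessing v̄(G) ≤ r: additionally each C_i has size ≥ 2
VBarCover : ∀ {n} → Graph n → ℕ → Set
VBarCover {n} G r = Σ (Vec (Subset n) r) λ Cs → EdgeCliquePartition G Cs ×
  (∀ i → 2 ≤ ∣ lookup Cs i ∣)

IsMinimum : (ℕ → Set) → ℕ → Set
IsMinimum P m = P m × (∀ r → P r → m ≤ r)

LinIntNumber : ∀ {n} → Graph n → ℕ → Set
LinIntNumber G = IsMinimum (VCover G)

VBar : ∀ {n} → Graph n → ℕ → Set
VBar G = IsMinimum (VBarCover G)

Isolated : ∀ {n} → Graph n → Fin n → Set
Isolated G u = ∀ v → adj G u v ≡ false

isolatedCount : ∀ {n} → Graph n → ℕ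
isolatedCount {n} G =
  length (filter (λ u → ¬? (any? (λ v → T? (adj G u v)) (allFin n))) (allFin n))

IsUnionOfK1K2 : ∀ {n} → Graph n → Set
IsUnionOfK1K2 {n} G = ∀ u → Isolated G u ⊎
  Σ (Fin n) λ v → Adj G u v × (∀ w → Adj G u w → w ≡ v) × (∀ w → Adj G v w → w ≡ u)

{-# OPTIONS --safe #-}
module Submission where

-- Adding to a minimum edge clique partition P (cliques of size ≥ 2) the singleton {u} of every
-- vertex, and a second one of every isolated vertex, puts every vertex into two cliques; hence
-- v ≤ v̄ + n + e.  If some w has neighbours a ≠ b, let C be the clique of P through wa: replacing C
-- by C − w and the singletons {x}, x ∈ C − w, by the pairs {w, x} makes {w} superfluous, because w
-- lies in {w, a} and in {w, b} or the clique through wb.  So equality forces a union of K₁'s and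
-- K₂'s.  Conversely, for such a graph the cliques with two vertices of any admissible list form an
-- edge clique partition, so there are at least v̄ of them.  A vertex lies in at most one of them,
-- and in none if it is isolated, so double counting the remaining cliques, which have at most one
-- vertex each, shows that there are at least n + e of those.

open import Defs renaming (sym to adj-sym; irrefl to adj-irrefl)
open import Level using (Level; 0ℓ)
open import Algebra.Properties.CommutativeSemigroup using (interchange; x∙yz≈y∙xz)
open import Data.Bool as Bool using (true; T)
open import Data.Bool.Properties using (T?; ¬-not)
open import Data.Unit using (tt)
open import Data.Nat using (ℕ; zero; suc; _+_; _≤_; _<_; z≤n; s≤s; s≤s⁻¹; _≤?_)
open import Data.Nat.Properties
  using (module ≤-Reasoning; ≤-trans; ≤-reflexive; ≤-antisym; ≤-<-trans; <-irrefl; m≤n⇒m≤1+n;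
         m≤m+n; m≤n+m; +-mono-≤; +-monoˡ-≤; +-monoʳ-<; +-monoˡ-<; +-suc; +-comm; +-assoc;
         +-identityʳ; suc-injective; +-commutativeSemigroup)
open import Data.Nat.ListAction using (sum)
open import Data.Fin as Fin using (Fin; zero; suc)
import Data.Fin.Properties as Fin
open import Data.Fin.Properties using (_≟_; _<?_; any?; all?)
open import Data.Fin.Subset using (Subset; _∈_; _∉_; _⊂_; ∣_∣; ⁅_⁆; _∪_; _∩_; ∁)
open import Data.Fin.Subset.Properties
  using (_∈?_; anySubset?; x∈⁅x⁆; x∈⁅y⁆⇒x≡y; x≢y⇒x∉⁅y⁆; x∉⁅y⁆⇒x≢y; ∣⁅x⁆∣≡1; p⊂q⇒∣p∣<∣q∣;
         x∈p∪q⁺; x∈p∪q⁻; x∈p∩q⁺; x∈p∩q⁻; x∉p⇒x∈∁p; x∈∁p⇒x∉p)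
open import Data.Vec using (Vec; []; _∷_; lookup; toList; fromList)
open import Data.Vec.Properties using (toList∘fromList; length-toList)
import Data.Vec.Relation.Unary.All.Properties as AllV
open import Data.List using (List; []; _∷_; [_]; _++_; map; filter; length; allFin; cartesianProduct)
open import Data.List.Properties
  using (filter-++; length-++; length-map; length-tabulate; length-filter; filter-none; filter-some;
         filter-all; filter-notAll; filter-≐; map-cong)
open import Data.List.Membership.Propositional using (find) renaming (_∈_ to _∈ₗ_; _∉_ to _∉ₗ_)
open import Data.List.Membership.Propositional.Properties
  using (∈-allFin; ∈-filter⁺; ∈-filter⁻; ∈-length; ∈-++⁺ˡ; ∈-∃++; ∈-cartesianProduct⁺)
open import Data.List.Relation.Unary.All as All using (All; []; _∷_)
import Data.List.Relation.Unary.All.Properties as All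
open import Data.List.Relation.Unary.Any as Any using (Any; here; there)
open import Data.List.Relation.Unary.AllPairs using (_∷_)
open import Data.List.Relation.Unary.Unique.Propositional using (Unique)
import Data.List.Relation.Unary.Unique.Propositional.Properties as Unique
open import Data.Product using (Σ; ∃; _×_; _,_; proj₁; proj₂; swap)
import Data.Product as Product
open import Data.Product.Properties using (≡-dec)
open import Data.Sum as Sum using (_⊎_; inj₁; inj₂)
open import Function using (_∘_; _∘′_; id)
open import Function.Bundles using (_⇔_; mk⇔)
open import Relation.Nullary using (¬_; Dec; yes; no; contradiction; ¬?)
open import Relation.Nullary.Decidable using (_×-dec_; _→-dec_; map′)
open import Relation.Unary using (Pred; Decidable; _≐_) renaming (∁ to ∁ᵤ)
open import Relation.Unary.Properties using (∁?)
open import Relation.Binary.Definitions using (DecidableEquality; tri<; tri≈; tri>)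
open import Relation.Binary.PropositionalEquality
  using (_≡_; _≢_; refl; sym; trans; cong; cong₂; subst; module ≡-Reasoning)

private
  variable
    a b p q : Level
    A : Set a
    B : Set b

module _ {P : Pred A p} (P? : Decidable P) where

  count : List A → ℕ
  count xs = length (filter P? xs)

  count-++ : ∀ xs ys → count (xs ++ ys) ≡ count xs + count ys
  count-++ xs ys = trans (cong length (filter-++ P? xs ys)) (length-++ (filter P? xs))

  count-none : ∀ {xs} → All (∁ᵤ P) xs → count xs ≡ 0
  count-none = cong length ∘ filter-none P?

  count-some : ∀ {xs} → Any P xs → 1 ≤ count xs
  count-some = filter-some P?

  count-some⁻ : ∀ xs → 1 ≤ count xs → Any P xs
  count-some⁻ (x ∷ xs) c with P? x
  ... | yes px = here px
  ... | no _   = there (count-some⁻ xs c)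

  count-all : ∀ {xs} → All P xs → count xs ≡ length xs
  count-all = cong length ∘ filter-all P?

  count≤1 : ∀ {xs} → Unique xs → (∀ {x y} → P x → P y → x ≡ y) → count xs ≤ 1
  count≤1 {[]}     _             _      = z≤n
  count≤1 {x ∷ xs} (x∉xs ∷ uxs) single with P? x
  ... | yes px = s≤s (≤-reflexive (count-none (All.map (λ x≢y py → x≢y (single px py)) x∉xs)))
  ... | no _   = count≤1 uxs single

  count-middle : ∀ xs y zs → count (xs ++ y ∷ zs) ≡ count [ y ] + count (xs ++ zs)
  count-middle xs y zs = begin
    count (xs ++ y ∷ zs)                ≡⟨ count-++ xs (y ∷ zs) ⟩
    count xs + count (y ∷ zs)           ≡⟨ cong (count xs +_) (count-++ [ y ] zs) ⟩
    count xs + (count [ y ] + count zs)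
      ≡⟨ x∙yz≈y∙xz +-commutativeSemigroup (count xs) (count [ y ]) (count zs) ⟩
    count [ y ] + (count xs + count zs) ≡⟨ cong (count [ y ] +_) (count-++ xs zs) ⟨
    count [ y ] + count (xs ++ zs)      ∎
    where open ≡-Reasoning

  sum-count-[-] : ∀ xs → sum (map (λ x → count [ x ]) xs) ≡ count xs
  sum-count-[-] []       = refl
  sum-count-[-] (x ∷ xs) = trans (cong (count [ x ] +_) (sum-count-[-] xs)) (sym (count-++ [ x ] xs))

module _ {P : Pred A p} {Q : Pred A q} (P? : Decidable P) (Q? : Decidable Q) where

  count-mono : ∀ {xs} → All (λ x → P x → Q x) xs → count P? xs ≤ count Q? xs
  count-mono {[]}     []           = z≤n
  count-mono {x ∷ xs} (P⇒Q ∷ P⇒Qs) with P? x | Q? x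
  ... | yes _  | yes _  = s≤s (count-mono P⇒Qs)
  ... | yes px | no ¬qx = contradiction (P⇒Q px) ¬qx
  ... | no _   | yes _  = m≤n⇒m≤1+n (count-mono P⇒Qs)
  ... | no _   | no _   = count-mono P⇒Qs

  count-cong : P ≐ Q → ∀ xs → count P? xs ≡ count Q? xs
  count-cong P≐Q = cong length ∘ filter-≐ P? Q? P≐Q

  count-partition : ∀ xs → count P? xs ≡ count P? (filter Q? xs) + count P? (filter (∁? Q?) xs)
  count-partition []       = refl
  count-partition (x ∷ xs) with Q? x
  ... | yes _ with P? x
  ...   | yes _ = cong suc (count-partition xs)
  ...   | no _  = count-partition xs
  count-partition (x ∷ xs) | no _ with P? x
  ...   | yes _ = trans (cong suc (count-partition xs)) (sym (+-suc _ _))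
  ...   | no _  = count-partition xs

count+count-∁ : ∀ {P : Pred A p} (P? : Decidable P) xs →
                count P? xs + count (∁? P?) xs ≡ length xs
count+count-∁ P? []       = refl
count+count-∁ P? (x ∷ xs) with P? x
... | yes _ = cong suc (count+count-∁ P? xs)
... | no _  = trans (+-suc _ _) (cong suc (count+count-∁ P? xs))

count-[-] : ∀ {P : Pred A p} {Q : Pred B q} (P? : Decidable P) (Q? : Decidable Q) {x y} →
            (P x → Q y) → (Q y → P x) → count P? [ x ] ≡ count Q? [ y ]
count-[-] P? Q? {x} {y} P⇒Q Q⇒P with P? x | Q? y
... | yes _  | yes _  = refl
... | yes px | no ¬qy = contradiction (P⇒Q px) ¬qy
... | no ¬px | yes qy = contradiction (Q⇒P qy) ¬px
... | no _   | no _   = refl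

count-map : ∀ {P : Pred B p} (P? : Decidable P) (f : A → B) xs →
            count P? (map f xs) ≡ count (P? ∘ f) xs
count-map P? f []       = refl
count-map P? f (x ∷ xs) with P? (f x)
... | yes _ = cong suc (count-map P? f xs)
... | no _  = count-map P? f xs

module _ (_≟ₐ_ : DecidableEquality A) where

  count-≟-unique : ∀ {x xs} → Unique xs → x ∈ₗ xs → count (x ≟ₐ_) xs ≡ 1
  count-≟-unique {x} unique x∈xs =
    ≤-antisym (count≤1 (x ≟ₐ_) unique (λ x≡y x≡z → trans (sym x≡y) x≡z)) (count-some (x ≟ₐ_) x∈xs)

  count-≟-∉ : ∀ {x xs} → x ∉ₗ xs → count (x ≟ₐ_) xs ≡ 0
  count-≟-∉ {x} = count-none (x ≟ₐ_) ∘ All.¬Any⇒All¬ _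

  count-≟-filter : ∀ {Q : Pred A q} (Q? : Decidable Q) {x xs} → Unique xs → x ∈ₗ xs →
                   count (x ≟ₐ_) (filter Q? xs) ≡ count Q? [ x ]
  count-≟-filter Q? {x} {xs} unique x∈xs with Q? x
  ... | yes qx = count-≟-unique (Unique.filter⁺ Q? unique) (∈-filter⁺ Q? x∈xs qx)
  ... | no ¬qx = count-≟-∉ (¬qx ∘ proj₂ ∘ ∈-filter⁻ Q? {xs = xs})

2≤length : ∀ {x y} {xs : List A} → x ∈ₗ xs → y ∈ₗ xs → x ≢ y → 2 ≤ length xs
2≤length (here refl) (here refl) x≢y = contradiction refl x≢y
2≤length (here _)    (there y∈)  _   = s≤s (∈-length y∈)
2≤length (there x∈)  (here _)    _   = s≤s (∈-length x∈)
2≤length (there x∈)  (there y∈)  x≢y = m≤n⇒m≤1+n (2≤length x∈ y∈ x≢y)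

module _ {f g : A → ℕ} where

  sum-map-+ : ∀ xs → sum (map (λ x → f x + g x) xs) ≡ sum (map f xs) + sum (map g xs)
  sum-map-+ []       = refl
  sum-map-+ (x ∷ xs) =
    trans (cong (f x + g x +_) (sum-map-+ xs)) (interchange +-commutativeSemigroup (f x) (g x) _ _)

  sum-map-mono : (∀ x → f x ≤ g x) → ∀ xs → sum (map f xs) ≤ sum (map g xs)
  sum-map-mono f≤g []       = z≤n
  sum-map-mono f≤g (x ∷ xs) = +-mono-≤ (f≤g x) (sum-map-mono f≤g xs)

sum-map-0 : ∀ (xs : List A) → sum (map (λ _ → 0) xs) ≡ 0
sum-map-0 []       = refl
sum-map-0 (x ∷ xs) = sum-map-0 xs

sum-map-suc : ∀ (f : A → ℕ) xs → sum (map (suc ∘ f) xs) ≡ length xs + sum (map f xs)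
sum-map-suc f []       = refl
sum-map-suc f (x ∷ xs) =
  cong suc (trans (cong (f x +_) (sum-map-suc f xs)) (x∙yz≈y∙xz +-commutativeSemigroup (f x) (length xs) _))

sum-map-≤1 : ∀ {f : A → ℕ} {xs} → All (λ x → f x ≤ 1) xs → sum (map f xs) ≤ length xs
sum-map-≤1 []            = z≤n
sum-map-≤1 (fx≤1 ∷ f≤1) = +-mono-≤ fx≤1 (sum-map-≤1 f≤1)

sum-count-swap : ∀ {R : A → B → Set p} (R? : ∀ x y → Dec (R x y)) xs ys →
                 sum (map (λ x → count (R? x) ys) xs) ≡ sum (map (λ y → count (λ x → R? x y) xs) ys)
sum-count-swap R? xs []       = sum-map-0 xs
sum-count-swap R? xs (y ∷ ys) = begin
  sum (map (λ x → count (R? x) (y ∷ ys)) xs)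
    ≡⟨ cong sum (map-cong (λ x → count-++ (R? x) [ y ] ys) xs) ⟩
  sum (map (λ x → count (R? x) [ y ] + count (R? x) ys) xs)
    ≡⟨ sum-map-+ xs ⟩
  sum (map (λ x → count (R? x) [ y ]) xs) + sum (map (λ x → count (R? x) ys) xs)
    ≡⟨ cong₂ _+_ (trans (cong sum (map-cong (λ x → count-[-] (R? x) (λ x′ → R? x′ y) id id) xs))
                        (sum-count-[-] (λ x → R? x y) xs))
                 (sum-count-swap R? xs ys) ⟩
  count (λ x → R? x y) xs + sum (map (λ y → count (λ x → R? x y) xs) ys) ∎
  where open ≡-Reasoning

ExactlyOneIndex : ∀ {r} → Pred A p → Vec A r → Set p
ExactlyOneIndex {r = r} P xs = Σ (Fin r) λ i → P (lookup xs i) × ∀ j → P (lookup xs j) → j ≡ i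

TwoIndices : ∀ {r} → Pred A p → Vec A r → Set p
TwoIndices {r = r} P xs = Σ (Fin r) λ i → Σ (Fin r) λ j → i ≢ j × P (lookup xs i) × P (lookup xs j)

module _ {P : Pred A p} (P? : Decidable P) where

  1≤count-toList : ∀ {r} (xs : Vec A r) i → P (lookup xs i) → 1 ≤ count P? (toList xs)
  1≤count-toList (x ∷ xs) i pi with P? x
  1≤count-toList (x ∷ xs) i       pi | yes _  = s≤s z≤n
  1≤count-toList (x ∷ xs) zero    px | no ¬px = contradiction px ¬px
  1≤count-toList (x ∷ xs) (suc i) pi | no _   = 1≤count-toList xs i pi

  1≤count-toList⁻ : ∀ {r} (xs : Vec A r) → 1 ≤ count P? (toList xs) → ∃ λ i → P (lookup xs i)
  1≤count-toList⁻ (x ∷ xs) c with P? x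
  ... | yes px = zero , px
  ... | no _   = let i , pi = 1≤count-toList⁻ xs c in suc i , pi

  count-toList≡0 : ∀ {r} (xs : Vec A r) → (∀ i → ¬ P (lookup xs i)) → count P? (toList xs) ≡ 0
  count-toList≡0 xs none = count-none P? (AllV.toList⁺ (AllV.lookup⁻ {xs = xs} none))

  count-toList≡0⁻ : ∀ {r} (xs : Vec A r) → count P? (toList xs) ≡ 0 → ∀ i → ¬ P (lookup xs i)
  count-toList≡0⁻ xs c i pi with () ← subst (1 ≤_) c (1≤count-toList xs i pi)

  count-toList≡1 : ∀ {r} (xs : Vec A r) → ExactlyOneIndex P xs → count P? (toList xs) ≡ 1
  count-toList≡1 (x ∷ xs) (i , pi , unique) with P? x | i
  ... | yes _  | zero  = cong suc (count-toList≡0 xs λ j pj → Fin.0≢1+n (sym (unique (suc j) pj)))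
  ... | yes px | suc _ = contradiction (unique zero px) Fin.0≢1+n
  ... | no ¬px | zero  = contradiction pi ¬px
  ... | no _   | suc i = count-toList≡1 xs (i , pi , λ j pj → Fin.suc-injective (unique (suc j) pj))

  count-toList≡1⁻ : ∀ {r} (xs : Vec A r) → count P? (toList xs) ≡ 1 → ExactlyOneIndex P xs
  count-toList≡1⁻ (x ∷ xs) c with P? x
  ... | yes px = zero , px , λ where
    zero    _  → refl
    (suc j) pj → contradiction pj (count-toList≡0⁻ xs (suc-injective c) j)
  ... | no ¬px = let i , pi , unique = count-toList≡1⁻ xs c in
    suc i , pi , λ where
      zero    px → contradiction px ¬px
      (suc j) pj → cong suc (unique j pj)

  2≤count-toList : ∀ {r} (xs : Vec A r) → TwoIndices P xs → 2 ≤ count P? (toList xs)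
  2≤count-toList (x ∷ xs) (i , j , i≢j , pi , pj) with P? x | i | j
  ... | _      | zero  | zero  = contradiction refl i≢j
  ... | yes _  | zero  | suc j = s≤s (1≤count-toList xs j pj)
  ... | yes _  | suc i | zero  = s≤s (1≤count-toList xs i pi)
  ... | yes _  | suc i | suc j = m≤n⇒m≤1+n (2≤count-toList xs (i , j , i≢j ∘′ cong suc , pi , pj))
  ... | no ¬px | zero  | suc _ = contradiction pi ¬px
  ... | no ¬px | suc _ | zero  = contradiction pj ¬px
  ... | no _   | suc i | suc j = 2≤count-toList xs (i , j , i≢j ∘′ cong suc , pi , pj)

  2≤count-toList⁻ : ∀ {r} (xs : Vec A r) → 2 ≤ count P? (toList xs) → TwoIndices P xs
  2≤count-toList⁻ (x ∷ xs) c with P? x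
  ... | yes px = let j , pj = 1≤count-toList⁻ xs (s≤s⁻¹ c) in zero , suc j , (λ ()) , px , pj
  ... | no _   = let i , j , i≢j , pi , pj = 2≤count-toList⁻ xs c in
    suc i , suc j , i≢j ∘′ Fin.suc-injective , pi , pj

-- Existence of v(G) and v̄(G)

Searchable : Set → Set₁
Searchable A = ∀ {P : Pred A 0ℓ} → Decidable P → Dec (∃ P)

searchable-Vec : ∀ {A} → Searchable A → ∀ r → Searchable (Vec A r)
searchable-Vec search zero    P? = map′ ([] ,_) (λ { ([] , p) → p }) (P? [])
searchable-Vec search (suc r) P? =
  map′ (λ (x , xs , p) → x ∷ xs , p) (λ { (x ∷ xs , p) → x , xs , p })
       (search λ x → searchable-Vec search r (P? ∘ (x ∷_)))

least-witness : ∀ {P : Pred ℕ 0ℓ} → Decidable P → ∀ {m} → P m → ∃ (IsMinimum P)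
least-witness P? {m} pm with P? 0
... | yes p0 = 0 , p0 , λ _ _ → z≤n
least-witness P? {zero}  pm | no ¬p0 = contradiction pm ¬p0
least-witness P? {suc m} pm | no ¬p0 =
  let k , pk , least = least-witness (P? ∘ suc) pm in
  suc k , pk , λ where
    zero    p0 → contradiction p0 ¬p0
    (suc r) pr → s≤s (least r pr)

module _ {n : ℕ} (G : Graph n) where

  adj? : ∀ u v → Dec (Adj G u v)
  adj? u v = adj G u v Bool.≟ true

  clique? : Decidable (IsClique G)
  clique? C = all? λ u → all? λ v → u ∈? C →-dec (v ∈? C →-dec (¬? (u ≟ v) →-dec adj? u v))

  edgeCliquePartition? : ∀ {r} (Cs : Vec (Subset n) r) → Dec (EdgeCliquePartition G Cs)
  edgeCliquePartition? Cs =
    (all? λ i → clique? (lookup Cs i)) ×-dec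
    (all? λ u → all? λ v → adj? u v →-dec
      (any? λ i → (u ∈? lookup Cs i ×-dec v ∈? lookup Cs i) ×-dec
                  (all? λ j → u ∈? lookup Cs j →-dec (v ∈? lookup Cs j →-dec j ≟ i))))

  vCover? : ∀ r → Dec (VCover G r)
  vCover? r = searchable-Vec anySubset? r λ Cs → edgeCliquePartition? Cs ×-dec
    (all? λ u → any? λ i → any? λ j → ¬? (i ≟ j) ×-dec (u ∈? lookup Cs i ×-dec u ∈? lookup Cs j))

  vBarCover? : ∀ r → Dec (VBarCover G r)
  vBarCover? r = searchable-Vec anySubset? r λ Cs → edgeCliquePartition? Cs ×-dec
    (all? λ i → 2 ≤? ∣ lookup Cs i ∣)

-- Lists rather than the vectors of Defs: concatenation and filtering then act additively on counts.

module _ {n : ℕ} {x y : Fin n} where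

  x∈⁅x⁆∪⁅y⁆ : x ∈ ⁅ x ⁆ ∪ ⁅ y ⁆
  x∈⁅x⁆∪⁅y⁆ = x∈p∪q⁺ (inj₁ (x∈⁅x⁆ x))

  y∈⁅x⁆∪⁅y⁆ : y ∈ ⁅ x ⁆ ∪ ⁅ y ⁆
  y∈⁅x⁆∪⁅y⁆ = x∈p∪q⁺ (inj₂ (x∈⁅x⁆ y))

  ∈-⁅x⁆∪⁅y⁆⁻ : ∀ {z} → z ∈ ⁅ x ⁆ ∪ ⁅ y ⁆ → z ≡ x ⊎ z ≡ y
  ∈-⁅x⁆∪⁅y⁆⁻ z∈ = Sum.map (x∈⁅y⁆⇒x≡y x) (x∈⁅y⁆⇒x≡y y) (x∈p∪q⁻ ⁅ x ⁆ ⁅ y ⁆ z∈)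

2≤∣p∣ : ∀ {n} {p : Subset n} {x y} → x ∈ p → y ∈ p → x ≢ y → 2 ≤ ∣ p ∣
2≤∣p∣ {p = p} {x} {y} x∈p y∈p x≢y = subst (_< ∣ p ∣) (∣⁅x⁆∣≡1 x) (p⊂q⇒∣p∣<∣q∣ ⁅x⁆⊂p)
  where
  ⁅x⁆⊂p : ⁅ x ⁆ ⊂ p
  ⁅x⁆⊂p = (λ z∈ → subst (_∈ p) (sym (x∈⁅y⁆⇒x≡y x z∈)) x∈p) , y , y∈p , x≢y ∘ sym ∘ x∈⁅y⁆⇒x≡y x

both? : ∀ {n} (u v : Fin n) → Decidable (λ C → u ∈ C × v ∈ C)
both? u v C = u ∈? C ×-dec v ∈? C

module _ {n : ℕ} (G : Graph n) where

  IsEdgeCliquePartition : List (Subset n) → Set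
  IsEdgeCliquePartition L = All (IsClique G) L × (∀ u v → Adj G u v → count (both? u v) L ≡ 1)

  IsVCover : List (Subset n) → Set
  IsVCover L = IsEdgeCliquePartition L × (∀ u → 2 ≤ count (u ∈?_) L)

  IsVBarCover : List (Subset n) → Set
  IsVBarCover L = IsEdgeCliquePartition L × All (λ C → 2 ≤ ∣ C ∣) L

  module _ {r} (Cs : Vec (Subset n) r) where

    toList-edgeCliquePartition : EdgeCliquePartition G Cs → IsEdgeCliquePartition (toList Cs)
    toList-edgeCliquePartition (cliques , edges) =
      AllV.toList⁺ (AllV.lookup⁻ cliques) ,
      λ u v uv → let i , ∈i , unique = edges u v uv in
        count-toList≡1 (both? u v) Cs (i , ∈i , λ j (u∈j , v∈j) → unique j u∈j v∈j)

    toList-edgeCliquePartition⁻ : IsEdgeCliquePartition (toList Cs) → EdgeCliquePartition G Cs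
    toList-edgeCliquePartition⁻ (cliques , edges) =
      AllV.lookup⁺ (AllV.toList⁻ cliques) ,
      λ u v uv → let i , ∈i , unique = count-toList≡1⁻ (both? u v) Cs (edges u v uv) in
        i , ∈i , λ j u∈j v∈j → unique j (u∈j , v∈j)

  toList-vCover : ∀ {r} → VCover G r → ∃ λ L → length L ≡ r × IsVCover L
  toList-vCover (Cs , ecp , twice) =
    toList Cs , length-toList Cs , toList-edgeCliquePartition Cs ecp ,
    λ u → 2≤count-toList (u ∈?_) Cs (twice u)

  fromList-vCover : ∀ {L} → IsVCover L → VCover G (length L)
  fromList-vCover {L} cover =
    let ecp , twice = subst IsVCover (sym (toList∘fromList L)) cover in
    fromList L , toList-edgeCliquePartition⁻ (fromList L) ecp ,
    λ u → 2≤count-toList⁻ (u ∈?_) (fromList L) (twice u)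

  toList-vBarCover : ∀ {r} → VBarCover G r → ∃ λ L → length L ≡ r × IsVBarCover L
  toList-vBarCover (Cs , ecp , sizes) =
    toList Cs , length-toList Cs , toList-edgeCliquePartition Cs ecp , AllV.toList⁺ (AllV.lookup⁻ sizes)

  fromList-vBarCover : ∀ {L} → IsVBarCover L → VBarCover G (length L)
  fromList-vBarCover {L} cover =
    let ecp , sizes = subst IsVBarCover (sym (toList∘fromList L)) cover in
    fromList L , toList-edgeCliquePartition⁻ (fromList L) ecp , AllV.lookup⁺ (AllV.toList⁻ sizes)

module _ {n : ℕ} (G : Graph n) where

  adj⇒≢ : ∀ {u v} → Adj G u v → u ≢ v
  adj⇒≢ {u} uv refl with () ← trans (sym uv) (adj-irrefl G u)

  adj-symmetric : ∀ {u v} → Adj G u v → Adj G v u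
  adj-symmetric {u} {v} uv = trans (adj-sym G v u) uv

  isolated-or-adjacent : ∀ u → Isolated G u ⊎ ∃ (Adj G u)
  isolated-or-adjacent u with any? (adj? G u)
  ... | yes adjacent = inj₂ adjacent
  ... | no ¬adjacent = inj₁ λ v → ¬-not (¬adjacent ∘ (v ,_))

  -- The test used by isolatedCount, so that isolatedCount G ≡ length isolatedVertices by definition.
  isolated? : Decidable (λ u → ¬ Any (λ v → T (adj G u v)) (allFin n))
  isolated? u = ¬? (Any.any? (λ v → T? (adj G u v)) (allFin n))

  isolatedVertices : List (Fin n)
  isolatedVertices = filter isolated? (allFin n)

  adj⇒any : ∀ {u v} → Adj G u v → Any (λ v → T (adj G u v)) (allFin n)
  adj⇒any uv = Any.map (λ { refl → subst T (sym uv) tt }) (∈-allFin _)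

  ∈-isolatedVertices : ∀ {u} → Isolated G u → u ∈ₗ isolatedVertices
  ∈-isolatedVertices {u} isolated = ∈-filter⁺ isolated? (∈-allFin u) λ adjacent →
    let v , t = Any.satisfied adjacent in subst T (isolated v) t

  ⁅⁆-clique : ∀ x → IsClique G ⁅ x ⁆
  ⁅⁆-clique x u v u∈ v∈ u≢v = contradiction (trans (x∈⁅y⁆⇒x≡y x u∈) (sym (x∈⁅y⁆⇒x≡y x v∈))) u≢v

  adj⇒¬both-⁅⁆ : ∀ {u v} → Adj G u v → ∀ x → ¬ (u ∈ ⁅ x ⁆ × v ∈ ⁅ x ⁆)
  adj⇒¬both-⁅⁆ uv x (u∈ , v∈) = adj⇒≢ uv (trans (x∈⁅y⁆⇒x≡y x u∈) (sym (x∈⁅y⁆⇒x≡y x v∈)))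

  adj⇒1≤count-∈ : ∀ {L u v} → IsEdgeCliquePartition G L → Adj G u v → 1 ≤ count (u ∈?_) L
  adj⇒1≤count-∈ {L} {u} {v} (_ , edges) uv =
    subst (_≤ count (u ∈?_) L) (edges u v uv)
          (count-mono (both? u v) (u ∈?_) (All.universal (λ _ → proj₁) L))

  ++-singletons : ∀ {L} → IsEdgeCliquePartition G L → ∀ xs → IsEdgeCliquePartition G (L ++ map ⁅_⁆ xs)
  ++-singletons {L} (cliques , edges) xs =
    All.++⁺ cliques (All.map⁺ (All.universal ⁅⁆-clique xs)) ,
    λ u v uv → begin
      count (both? u v) (L ++ map ⁅_⁆ xs)                    ≡⟨ count-++ (both? u v) L (map ⁅_⁆ xs) ⟩
      count (both? u v) L + count (both? u v) (map ⁅_⁆ xs)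
        ≡⟨ cong₂ _+_ (edges u v uv)
                     (count-none (both? u v) (All.map⁺ (All.universal (adj⇒¬both-⁅⁆ uv) xs))) ⟩
      1                                                      ∎
    where open ≡-Reasoning

  count-∈-++-⁅⁆ : ∀ u L (xs : List (Fin n)) →
                   count (u ∈?_) (L ++ map ⁅_⁆ xs) ≡ count (u ∈?_) L + count (u ≟_) xs
  count-∈-++-⁅⁆ u L xs = begin
    count (u ∈?_) (L ++ map ⁅_⁆ xs)                ≡⟨ count-++ (u ∈?_) L (map ⁅_⁆ xs) ⟩
    count (u ∈?_) L + count (u ∈?_) (map ⁅_⁆ xs)   ≡⟨ cong (count (u ∈?_) L +_) (count-map (u ∈?_) ⁅_⁆ xs) ⟩
    count (u ∈?_) L + count (λ x → u ∈? ⁅ x ⁆) xs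
      ≡⟨ cong (count (u ∈?_) L +_) (count-cong _ (u ≟_) ((λ {x} → x∈⁅y⁆⇒x≡y x) , λ { refl → x∈⁅x⁆ u }) xs) ⟩
    count (u ∈?_) L + count (u ≟_) xs              ∎
    where open ≡-Reasoning

-- The upper bound

module _ {n : ℕ} (G : Graph n) {L : List (Subset n)} (partition : IsEdgeCliquePartition G L) where

  withSingletons : List (Subset n)
  withSingletons = L ++ map ⁅_⁆ (allFin n ++ isolatedVertices G)

  withSingletons-vCover : IsVCover G withSingletons
  withSingletons-vCover = ++-singletons G partition _ , λ u →
    subst (2 ≤_) (sym (count-∈-++-⁅⁆ G u L _)) (twice u)
    where
    twice : ∀ u → 2 ≤ count (u ∈?_) L + count (u ≟_) (allFin n ++ isolatedVertices G)
    twice u with isolated-or-adjacent G u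
    ... | inj₁ isolated = ≤-trans
      (subst (2 ≤_) (sym (count-++ (u ≟_) (allFin n) (isolatedVertices G)))
             (+-mono-≤ (count-some (u ≟_) (∈-allFin u)) (count-some (u ≟_) (∈-isolatedVertices G isolated))))
      (m≤n+m _ _)
    ... | inj₂ (v , uv) = +-mono-≤ (adj⇒1≤count-∈ G partition uv) (count-some (u ≟_) (∈-++⁺ˡ (∈-allFin u)))

  length-withSingletons : length withSingletons ≡ length L + n + isolatedCount G
  length-withSingletons = begin
    length (L ++ map ⁅_⁆ (allFin n ++ isolatedVertices G))        ≡⟨ length-++ L ⟩
    length L + length (map ⁅_⁆ (allFin n ++ isolatedVertices G))
      ≡⟨ cong (length L +_) (trans (length-map ⁅_⁆ (allFin n ++ _)) (length-++ (allFin n))) ⟩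
    length L + (length (allFin n) + isolatedCount G)
      ≡⟨ cong (λ m → length L + (m + isolatedCount G)) (length-tabulate id) ⟩
    length L + (n + isolatedCount G)                               ≡⟨ +-assoc (length L) n _ ⟨
    length L + n + isolatedCount G                                 ∎
    where open ≡-Reasoning

-- Splitting a clique at a vertex

module Split {n : ℕ} (G : Graph n) (pre post : List (Subset n)) {C : Subset n}
             (partition : IsEdgeCliquePartition G (pre ++ C ∷ post)) {w : Fin n} (w∈C : w ∈ C) where

  rest : List (Subset n)
  rest = pre ++ post

  others : List (Fin n)
  others = filter (λ x → ¬? (x ≟ w)) (allFin n)

  inside outside : List (Fin n)
  inside  = filter (_∈? C) others
  outside = filter (∁? (_∈? C)) others

  C-w : Subset n
  C-w = C ∩ ∁ ⁅ w ⁆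

  link : Fin n → Subset n
  link x = ⁅ w ⁆ ∪ ⁅ x ⁆

  -- C − w and the pairs {w, x}, x ∈ C − w, cover each edge of C exactly once.
  split : List (Subset n)
  split = (pre ++ C-w ∷ post) ++ map link inside

  ∈-others : ∀ {x} → x ≢ w → x ∈ₗ others
  ∈-others x≢w = ∈-filter⁺ (λ x → ¬? (x ≟ w)) (∈-allFin _) x≢w

  ∈-inside : ∀ {x} → x ∈ C → x ≢ w → x ∈ₗ inside
  ∈-inside x∈C x≢w = ∈-filter⁺ (_∈? C) (∈-others x≢w) x∈C

  ∈-inside⁻ : ∀ {x} → x ∈ₗ inside → x ∈ C × x ≢ w
  ∈-inside⁻ x∈ = let x∈others , x∈C = ∈-filter⁻ (_∈? C) {xs = others} x∈ in
    x∈C , proj₂ (∈-filter⁻ (λ x → ¬? (x ≟ w)) {xs = allFin n} x∈others)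

  ∈-outside : ∀ {x} → x ∉ C → x ∈ₗ outside
  ∈-outside x∉C = ∈-filter⁺ (∁? (_∈? C)) (∈-others λ { refl → x∉C w∈C }) x∉C

  ∈-C-w : ∀ {x} → x ∈ C → x ≢ w → x ∈ C-w
  ∈-C-w x∈C x≢w = x∈p∩q⁺ (x∈C , x∉p⇒x∈∁p (x≢y⇒x∉⁅y⁆ x≢w))

  ∈-C-w⁻ : ∀ {x} → x ∈ C-w → x ∈ C × x ≢ w
  ∈-C-w⁻ x∈ = let x∈C , x∈∁ = x∈p∩q⁻ C _ x∈ in x∈C , x∉⁅y⁆⇒x≢y (x∈∁p⇒x∉p x∈∁)

  split-cliques : All (IsClique G) split
  split-cliques =
    All.++⁺ (All.++⁺ pre-cliques (C-w-clique ∷ post-cliques)) (All.map⁺ (All.tabulate link-clique))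
    where
    pre-cliques : All (IsClique G) pre
    pre-cliques = proj₁ (All.++⁻ pre (proj₁ partition))

    C-clique : IsClique G C
    C-clique = All.head (proj₂ (All.++⁻ pre (proj₁ partition)))

    post-cliques : All (IsClique G) post
    post-cliques = All.tail (proj₂ (All.++⁻ pre (proj₁ partition)))

    C-w-clique : IsClique G C-w
    C-w-clique u v u∈ v∈ = C-clique u v (proj₁ (∈-C-w⁻ u∈)) (proj₁ (∈-C-w⁻ v∈))

    link-clique : ∀ {x} → x ∈ₗ inside → IsClique G (link x)
    link-clique {x} x∈ u v u∈ v∈ = C-clique u v (link⊆C u∈) (link⊆C v∈)
      where
      link⊆C : ∀ {y} → y ∈ link x → y ∈ C
      link⊆C y∈ with ∈-⁅x⁆∪⁅y⁆⁻ y∈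
      ... | inj₁ refl = w∈C
      ... | inj₂ refl = proj₁ (∈-inside⁻ x∈)

  count-split : ∀ {P : Pred (Subset n) 0ℓ} (P? : Decidable P) →
                count P? split ≡ count P? [ C-w ] + count P? rest + count P? (map link inside)
  count-split P? = trans (count-++ P? (pre ++ C-w ∷ post) (map link inside))
                         (cong (_+ count P? (map link inside)) (count-middle P? pre C-w post))

  count-C+rest : ∀ {u v} → Adj G u v → count (both? u v) [ C ] + count (both? u v) rest ≡ 1
  count-C+rest {u} {v} uv = trans (sym (count-middle (both? u v) pre C post)) (proj₂ partition u v uv)

  count-rest : ∀ {u v} → Adj G u v → ¬ (u ∈ C × v ∈ C) → count (both? u v) rest ≡ 1
  count-rest {u} {v} uv ¬both = subst (λ k → k + count (both? u v) rest ≡ 1)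
                                      (count-none (both? u v) (¬both ∷ [])) (count-C+rest uv)

  edge-away-from-w : ∀ {u v} → u ≢ w → v ≢ w → Adj G u v → count (both? u v) split ≡ 1
  edge-away-from-w {u} {v} u≢w v≢w uv = begin
    count (both? u v) split
      ≡⟨ count-split (both? u v) ⟩
    count (both? u v) [ C-w ] + count (both? u v) rest + count (both? u v) (map link inside)
      ≡⟨ cong₂ (λ k m → k + count (both? u v) rest + m)
               (count-[-] (both? u v) (both? u v) (Product.map (proj₁ ∘ ∈-C-w⁻) (proj₁ ∘ ∈-C-w⁻))
                                                  (λ (u∈ , v∈) → ∈-C-w u∈ u≢w , ∈-C-w v∈ v≢w))
               (count-none (both? u v) (All.map⁺ (All.universal ¬both-link inside))) ⟩
    count (both? u v) [ C ] + count (both? u v) rest + 0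
      ≡⟨ trans (+-identityʳ _) (count-C+rest uv) ⟩
    1 ∎
    where
    open ≡-Reasoning
    ¬both-link : ∀ x → ¬ (u ∈ link x × v ∈ link x)
    ¬both-link x (u∈ , v∈) with ∈-⁅x⁆∪⁅y⁆⁻ u∈ | ∈-⁅x⁆∪⁅y⁆⁻ v∈
    ... | inj₁ u≡w | _        = u≢w u≡w
    ... | inj₂ _   | inj₁ v≡w = v≢w v≡w
    ... | inj₂ u≡x | inj₂ v≡x = adj⇒≢ G uv (trans u≡x (sym v≡x))

  edge-at-w : ∀ {v} → Adj G w v → count (both? w v) split ≡ 1
  edge-at-w {v} wv = begin
    count (both? w v) split
      ≡⟨ count-split (both? w v) ⟩
    count (both? w v) [ C-w ] + count (both? w v) rest + count (both? w v) (map link inside)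
      ≡⟨ cong₂ (λ k m → k + count (both? w v) rest + m)
               (count-none (both? w v) ((λ (w∈ , _) → proj₂ (∈-C-w⁻ w∈) refl) ∷ []))
               links ⟩
    count (both? w v) rest + count (both? w v) [ C ]   ≡⟨ +-comm (count (both? w v) rest) _ ⟩
    count (both? w v) [ C ] + count (both? w v) rest   ≡⟨ count-C+rest wv ⟩
    1                                                  ∎
    where
    open ≡-Reasoning
    v≢w : v ≢ w
    v≢w v≡w = adj⇒≢ G wv (sym v≡w)
    links : count (both? w v) (map link inside) ≡ count (both? w v) [ C ]
    links = begin
      count (both? w v) (map link inside)  ≡⟨ count-map (both? w v) link inside ⟩
      count (both? w v ∘ link) inside
        ≡⟨ count-cong (both? w v ∘ link) (v ≟_)
             ((λ (_ , v∈) → Sum.[ (λ v≡w → contradiction v≡w v≢w) , id ] (∈-⁅x⁆∪⁅y⁆⁻ v∈)) ,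
              λ { refl → x∈⁅x⁆∪⁅y⁆ , y∈⁅x⁆∪⁅y⁆ })
             inside ⟩
      count (v ≟_) inside
        ≡⟨ count-≟-filter _≟_ (_∈? C) (Unique.filter⁺ _ (Unique.allFin⁺ n)) (∈-others v≢w) ⟩
      count (_∈? C) [ v ]                  ≡⟨ count-[-] (_∈? C) (both? w v) (w∈C ,_) proj₂ ⟩
      count (both? w v) [ C ]              ∎

  split-partition : IsEdgeCliquePartition G split
  split-partition = split-cliques , edges
    where
    edges : ∀ u v → Adj G u v → count (both? u v) split ≡ 1
    edges u v uv with u ≟ w | v ≟ w
    ... | yes refl | _        = edge-at-w uv
    ... | no _     | yes refl = trans (count-cong (both? u v) (both? v u) (swap , swap) split)
                                      (edge-at-w (adj-symmetric G uv))
    ... | no u≢w   | no v≢w   = edge-away-from-w u≢w v≢w uv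

  strictCover : List (Subset n)
  strictCover = split ++ map ⁅_⁆ (outside ++ isolatedVertices G)

  rest+links≤split : ∀ u → count (u ∈?_) rest + count (u ∈?_) (map link inside) ≤ count (u ∈?_) split
  rest+links≤split u = ≤-trans (+-monoˡ-≤ (count (u ∈?_) (map link inside))
                                          (m≤n+m (count (u ∈?_) rest) (count (u ∈?_) [ C-w ])))
                                (≤-reflexive (sym (count-split (u ∈?_))))

  C-w+links≤split : ∀ u → count (u ∈?_) [ C-w ] + count (u ∈?_) (map link inside) ≤ count (u ∈?_) split
  C-w+links≤split u = ≤-trans (+-monoˡ-≤ (count (u ∈?_) (map link inside))
                                         (m≤m+n (count (u ∈?_) [ C-w ]) (count (u ∈?_) rest)))
                               (≤-reflexive (sym (count-split (u ∈?_))))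

  1≤count-∈-rest : ∀ {u v} → Adj G u v → ¬ (u ∈ C × v ∈ C) → 1 ≤ count (u ∈?_) rest
  1≤count-∈-rest {u} {v} uv ¬both = ≤-trans (≤-reflexive (sym (count-rest uv ¬both)))
    (count-mono (both? u v) (u ∈?_) (All.universal (λ _ → proj₁) rest))

  count-w-links : count (w ∈?_) (map link inside) ≡ length inside
  count-w-links = trans (count-map (w ∈?_) link inside)
                        (count-all _ (All.universal (λ _ → x∈⁅x⁆∪⁅y⁆) inside))

  module _ {a b : Fin n} (a∈C : a ∈ C) (wa : Adj G w a) (wb : Adj G w b) (a≢b : a ≢ b) where

    ≢w : ∀ {x} → Adj G w x → x ≢ w
    ≢w wx x≡w = adj⇒≢ G wx (sym x≡w)

    a∈inside : a ∈ₗ inside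
    a∈inside = ∈-inside a∈C (≢w wa)

    w-twice : 2 ≤ count (w ∈?_) split
    w-twice with b ∈? C
    ... | yes b∈C = ≤-trans (2≤length a∈inside (∈-inside b∈C (≢w wb)) a≢b)
                            (≤-trans (≤-reflexive (sym count-w-links))
                                     (≤-trans (m≤n+m _ _) (rest+links≤split w)))
    ... | no b∉C  = ≤-trans (+-mono-≤ (1≤count-∈-rest wb (b∉C ∘ proj₂))
                                      (subst (1 ≤_) (sym count-w-links) (∈-length a∈inside)))
                            (rest+links≤split w)

    strictCover-vCover : IsVCover G strictCover
    strictCover-vCover = ++-singletons G split-partition _ , λ u →
      subst (2 ≤_) (sym (count-∈-++-⁅⁆ G u split _)) (twice u)
      where
      twice : ∀ u → 2 ≤ count (u ∈?_) split + count (u ≟_) (outside ++ isolatedVertices G)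
      twice u with u ≟ w | u ∈? C
      ... | yes refl | _       = ≤-trans w-twice (m≤m+n _ _)
      ... | no u≢w   | yes u∈C = ≤-trans (≤-trans (+-mono-≤ in-C-w in-link) (C-w+links≤split u)) (m≤m+n _ _)
        where
        in-C-w : 1 ≤ count (u ∈?_) [ C-w ]
        in-C-w = count-some (u ∈?_) (here (∈-C-w u∈C u≢w))
        in-link : 1 ≤ count (u ∈?_) (map link inside)
        in-link = subst (1 ≤_) (sym (count-map (u ∈?_) link inside))
                        (count-some _ (Any.map (λ { refl → y∈⁅x⁆∪⁅y⁆ }) (∈-inside u∈C u≢w)))
      ... | no _     | no u∉C with isolated-or-adjacent G u
      ...   | inj₁ isolated = ≤-trans
        (subst (2 ≤_) (sym (count-++ (u ≟_) outside _))
               (+-mono-≤ (count-some (u ≟_) (∈-outside u∉C))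
                         (count-some (u ≟_) (∈-isolatedVertices G isolated))))
        (m≤n+m _ _)
      ...   | inj₂ (v , uv) = +-mono-≤
        (≤-trans (1≤count-∈-rest uv (u∉C ∘ proj₁)) (≤-trans (m≤m+n _ _) (rest+links≤split u)))
        (count-some (u ≟_) (∈-++⁺ˡ (∈-outside u∉C)))

  length-strictCover : length strictCover < length (pre ++ C ∷ post) + n + isolatedCount G
  length-strictCover = begin-strict
    length strictCover                                                            ≡⟨ lengths ⟩
    length (pre ++ C ∷ post) + (length inside + length outside) + isolatedCount G
      <⟨ +-monoˡ-< (isolatedCount G) (+-monoʳ-< (length (pre ++ C ∷ post)) inside+outside<n) ⟩
    length (pre ++ C ∷ post) + n + isolatedCount G                                ∎
    where
    open ≤-Reasoning
    inside+outside<n : length inside + length outside < n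
    inside+outside<n = begin-strict
      length inside + length outside  ≡⟨ count+count-∁ (_∈? C) others ⟩
      length others                   <⟨ filter-notAll (λ x → ¬? (x ≟ w)) (allFin n)
                                                       (Any.map (λ { refl w≢w → w≢w refl }) (∈-allFin w)) ⟩
      length (allFin n)               ≡⟨ length-tabulate id ⟩
      n                               ∎
    lengths : length strictCover ≡
              length (pre ++ C ∷ post) + (length inside + length outside) + isolatedCount G
    lengths = begin-equality
      length (split ++ map ⁅_⁆ (outside ++ isolatedVertices G))
        ≡⟨ length-++ split ⟩
      length split + length (map ⁅_⁆ (outside ++ isolatedVertices G))
        ≡⟨ cong₂ _+_ (trans (length-++ (pre ++ C-w ∷ post))
                            (cong₂ _+_ (trans (length-++ pre) (sym (length-++ pre))) (length-map link inside)))
                     (trans (length-map ⁅_⁆ (outside ++ isolatedVertices G)) (length-++ outside)) ⟩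
      length (pre ++ C ∷ post) + length inside + (length outside + isolatedCount G)
        ≡⟨ +-assoc (length (pre ++ C ∷ post) + length inside) (length outside) _ ⟨
      length (pre ++ C ∷ post) + length inside + length outside + isolatedCount G
        ≡⟨ cong (_+ isolatedCount G) (+-assoc (length (pre ++ C ∷ post)) _ _) ⟩
      length (pre ++ C ∷ post) + (length inside + length outside) + isolatedCount G ∎

Branching : ∀ {n} → Graph n → Fin n → Set
Branching {n} G w = Σ (Fin n) λ a → Σ (Fin n) λ b → a ≢ b × Adj G w a × Adj G w b

strict-vCover : ∀ {n} (G : Graph n) {L} → IsEdgeCliquePartition G L → ∀ {w} → Branching G w →
                ∃ λ L′ → IsVCover G L′ × length L′ < length L + n + isolatedCount G
strict-vCover G {L} partition {w} (a , b , a≢b , wa , wb)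
  with C , C∈L , w∈C , a∈C ← find (count-some⁻ (both? w a) L (≤-reflexive (sym (proj₂ partition w a wa))))
  with pre , post , refl ← ∈-∃++ C∈L
  = strictCover , strictCover-vCover a∈C wa wb a≢b , length-strictCover
  where open Split G pre post partition w∈C

-- The lower bound for unions of K₁ and K₂

module _ {n : ℕ} where

  HasTwoVertices : Subset n → Set
  HasTwoVertices C = Σ (Fin n) λ x → Σ (Fin n) λ y → x ∈ C × y ∈ C × x ≢ y

  hasTwoVertices? : Decidable HasTwoVertices
  hasTwoVertices? C = any? λ x → any? λ y → x ∈? C ×-dec (y ∈? C ×-dec ¬? (x ≟ y))

  hasTwoVertices⇒other : ∀ {C u} → HasTwoVertices C → u ∈ C → ∃ λ z → z ∈ C × u ≢ z
  hasTwoVertices⇒other {u = u} (x , y , x∈ , y∈ , x≢y) u∈ with x ≟ u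
  ... | yes refl = y , y∈ , x≢y
  ... | no x≢u   = x , x∈ , x≢u ∘ sym

  ¬hasTwoVertices⇒≡ : ∀ {C x y} → ¬ HasTwoVertices C → x ∈ C → y ∈ C → x ≡ y
  ¬hasTwoVertices⇒≡ {x = x} {y} ¬two x∈ y∈ with x ≟ y
  ... | yes x≡y = x≡y
  ... | no x≢y  = contradiction (x , y , x∈ , y∈ , x≢y) ¬two

module _ {n : ℕ} (G : Graph n) (k1k2 : IsUnionOfK1K2 G) {L : List (Subset n)} (cover : IsVCover G L) where

  big small : List (Subset n)
  big   = filter hasTwoVertices? L
  small = filter (∁? hasTwoVertices?) L

  big-cliques : All (λ C → IsClique G C × HasTwoVertices C) big
  big-cliques =
    All.zip (All.filter⁺ hasTwoVertices? (proj₁ (proj₁ cover)) , All.all-filter hasTwoVertices? L)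

  neighbour-in-big : ∀ {C u} → IsClique G C × HasTwoVertices C → u ∈ C → ∃ λ z → z ∈ C × Adj G u z
  neighbour-in-big (clique , two) u∈ = let z , z∈ , u≢z = hasTwoVertices⇒other two u∈ in
    z , z∈ , clique _ z u∈ z∈ u≢z

  big-vBarCover : IsVBarCover G big
  big-vBarCover =
    (All.map proj₁ big-cliques , edges) ,
    All.map (λ (_ , x , y , x∈ , y∈ , x≢y) → 2≤∣p∣ x∈ y∈ x≢y) big-cliques
    where
    edges : ∀ u v → Adj G u v → count (both? u v) big ≡ 1
    edges u v uv = begin
      count (both? u v) big                            ≡⟨ +-identityʳ _ ⟨
      count (both? u v) big + 0                        ≡⟨ cong (count (both? u v) big +_) none-small ⟨
      count (both? u v) big + count (both? u v) small  ≡⟨ count-partition (both? u v) hasTwoVertices? L ⟨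
      count (both? u v) L                              ≡⟨ proj₂ (proj₁ cover) u v uv ⟩
      1                                                ∎
      where
      open ≡-Reasoning
      none-small : count (both? u v) small ≡ 0
      none-small = count-none (both? u v) (All.map (λ ¬two (u∈ , v∈) → ¬two (u , v , u∈ , v∈ , adj⇒≢ G uv))
                                                   (All.all-filter (∁? hasTwoVertices?) L))

  count-∈-big≡0 : ∀ {u} → Isolated G u → count (u ∈?_) big ≡ 0
  count-∈-big≡0 {u} isolated = count-none (u ∈?_) (All.map ¬∈ big-cliques)
    where
    ¬∈ : ∀ {C} → IsClique G C × HasTwoVertices C → ¬ u ∈ C
    ¬∈ big-clique u∈ with z , _ , uz ← neighbour-in-big big-clique u∈ with () ← trans (sym uz) (isolated z)

  count-∈-big≤1 : ∀ {u v} → Adj G u v → (∀ z → Adj G u z → z ≡ v) → count (u ∈?_) big ≤ 1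
  count-∈-big≤1 {u} {v} uv only-v = begin
    count (u ∈?_) big                                 ≤⟨ count-mono (u ∈?_) (both? u v) (All.map u∈⇒both big-cliques) ⟩
    count (both? u v) big                             ≤⟨ m≤m+n _ _ ⟩
    count (both? u v) big + count (both? u v) small   ≡⟨ count-partition (both? u v) hasTwoVertices? L ⟨
    count (both? u v) L                               ≡⟨ proj₂ (proj₁ cover) u v uv ⟩
    1                                                 ∎
    where
    open ≤-Reasoning
    u∈⇒both : ∀ {C} → IsClique G C × HasTwoVertices C → u ∈ C → u ∈ C × v ∈ C
    u∈⇒both big-clique u∈ = let z , z∈ , uz = neighbour-in-big big-clique u∈ in
      u∈ , subst (_∈ _) (only-v z uz) z∈

  small-demand : ∀ u → suc (count (isolated? G) [ u ]) ≤ count (u ∈?_) small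
  small-demand u with k1k2 u
  ... | inj₁ isolated = ≤-trans (s≤s (length-filter (isolated? G) [ u ])) (begin
      2                                           ≤⟨ proj₂ cover u ⟩
      count (u ∈?_) L                             ≡⟨ count-partition (u ∈?_) hasTwoVertices? L ⟩
      count (u ∈?_) big + count (u ∈?_) small     ≡⟨ cong (_+ count (u ∈?_) small) (count-∈-big≡0 isolated) ⟩
      count (u ∈?_) small                         ∎)
    where open ≤-Reasoning
  ... | inj₂ (v , uv , only-v , _) = subst (λ k → suc k ≤ _) (sym not-isolated) (s≤s⁻¹ (begin
      2                                           ≤⟨ proj₂ cover u ⟩
      count (u ∈?_) L                             ≡⟨ count-partition (u ∈?_) hasTwoVertices? L ⟩
      count (u ∈?_) big + count (u ∈?_) small     ≤⟨ +-monoˡ-≤ _ (count-∈-big≤1 uv only-v) ⟩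
      1 + count (u ∈?_) small                     ∎))
    where
    open ≤-Reasoning
    not-isolated : count (isolated? G) [ u ] ≡ 0
    not-isolated = count-none (isolated? G) ((λ ¬any → ¬any (adj⇒any G uv)) ∷ [])

  n+e≤small : n + isolatedCount G ≤ length small
  n+e≤small = begin
    n + isolatedCount G
      ≡⟨ cong₂ _+_ (length-tabulate id) (sum-count-[-] (isolated? G) (allFin n)) ⟨
    length (allFin n) + sum (map (λ u → count (isolated? G) [ u ]) (allFin n))
      ≡⟨ sum-map-suc (λ u → count (isolated? G) [ u ]) (allFin n) ⟨
    sum (map (λ u → suc (count (isolated? G) [ u ])) (allFin n))
      ≤⟨ sum-map-mono small-demand (allFin n) ⟩
    sum (map (λ u → count (u ∈?_) small) (allFin n))
      ≡⟨ sum-count-swap _∈?_ (allFin n) small ⟩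
    sum (map (λ C → count (_∈? C) (allFin n)) small)
      ≤⟨ sum-map-≤1 (All.map (λ ¬two → count≤1 _ (Unique.allFin⁺ n) (¬hasTwoVertices⇒≡ ¬two))
                             (All.all-filter (∁? hasTwoVertices?) L)) ⟩
    length small ∎
    where open ≤-Reasoning

  lower-bound : ∀ {vbar} → VBar G vbar → vbar + n + isolatedCount G ≤ length L
  lower-bound {vbar} (_ , vbar-least) = begin
    vbar + n + isolatedCount G     ≡⟨ +-assoc vbar n _ ⟩
    vbar + (n + isolatedCount G)
      ≤⟨ +-mono-≤ (vbar-least _ (fromList-vBarCover G big-vBarCover)) n+e≤small ⟩
    length big + length small      ≡⟨ count+count-∁ hasTwoVertices? L ⟩
    length L                       ∎
    where open ≤-Reasoning

module _ {n : ℕ} (G : Graph n) where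

  pair-clique : ∀ {x y} → Adj G x y → IsClique G (⁅ x ⁆ ∪ ⁅ y ⁆)
  pair-clique xy u v u∈ v∈ u≢v with ∈-⁅x⁆∪⁅y⁆⁻ u∈ | ∈-⁅x⁆∪⁅y⁆⁻ v∈
  ... | inj₁ refl | inj₁ refl = contradiction refl u≢v
  ... | inj₁ refl | inj₂ refl = xy
  ... | inj₂ refl | inj₁ refl = adj-symmetric G xy
  ... | inj₂ refl | inj₂ refl = contradiction refl u≢v

  IsOrientedEdge : Fin n × Fin n → Set
  IsOrientedEdge (x , y) = x Fin.< y × Adj G x y

  orientedEdge? : Decidable IsOrientedEdge
  orientedEdge? (x , y) = x <? y ×-dec adj? G x y

  orientedEdges : List (Fin n × Fin n)
  orientedEdges = filter orientedEdge? (cartesianProduct (allFin n) (allFin n))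

  edgeSet : Fin n × Fin n → Subset n
  edgeSet (x , y) = ⁅ x ⁆ ∪ ⁅ y ⁆

  edgeSets-vBarCover : IsVBarCover G (map edgeSet orientedEdges)
  edgeSets-vBarCover =
    (All.map⁺ (All.map (λ { {x , y} (_ , xy) → pair-clique xy }) oriented) , edges) ,
    All.map⁺ (All.map (λ { {x , y} (x<y , _) → 2≤∣p∣ x∈⁅x⁆∪⁅y⁆ y∈⁅x⁆∪⁅y⁆ (Fin.<⇒≢ x<y) }) oriented)
    where
    oriented : All IsOrientedEdge orientedEdges
    oriented = All.all-filter orientedEdge? (cartesianProduct (allFin n) (allFin n))

    count-oriented : ∀ {u v} → u Fin.< v → Adj G u v → count (both? u v) (map edgeSet orientedEdges) ≡ 1
    count-oriented {u} {v} u<v uv = begin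
      count (both? u v) (map edgeSet orientedEdges)     ≡⟨ count-map (both? u v) edgeSet orientedEdges ⟩
      count (both? u v ∘ edgeSet) orientedEdges
        ≡⟨ ≤-antisym (count-mono _ _ (All.map (λ { {x , y} (x<y , _) → endpoints x<y }) oriented))
                     (count-mono _ _ (All.universal (λ { _ refl → x∈⁅x⁆∪⁅y⁆ , y∈⁅x⁆∪⁅y⁆ }) orientedEdges)) ⟩
      count (≡-dec _≟_ _≟_ (u , v)) orientedEdges
        ≡⟨ count-≟-filter (≡-dec _≟_ _≟_) orientedEdge?
                          (Unique.cartesianProduct⁺ (Unique.allFin⁺ n) (Unique.allFin⁺ n))
                          (∈-cartesianProduct⁺ (∈-allFin u) (∈-allFin v)) ⟩
      count orientedEdge? [ (u , v) ]
        ≡⟨ ≤-antisym (length-filter orientedEdge? [ (u , v) ]) (count-some orientedEdge? (here (u<v , uv))) ⟩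
      1 ∎
      where
      open ≡-Reasoning
      endpoints : ∀ {x y} → x Fin.< y → u ∈ ⁅ x ⁆ ∪ ⁅ y ⁆ × v ∈ ⁅ x ⁆ ∪ ⁅ y ⁆ → (u , v) ≡ (x , y)
      endpoints x<y (u∈ , v∈) with ∈-⁅x⁆∪⁅y⁆⁻ u∈ | ∈-⁅x⁆∪⁅y⁆⁻ v∈
      ... | inj₁ refl | inj₁ refl = contradiction refl (Fin.<⇒≢ u<v)
      ... | inj₁ refl | inj₂ refl = refl
      ... | inj₂ refl | inj₁ refl = contradiction u<v (Fin.<-asym x<y)
      ... | inj₂ refl | inj₂ refl = contradiction refl (Fin.<⇒≢ u<v)

    edges : ∀ u v → Adj G u v → count (both? u v) (map edgeSet orientedEdges) ≡ 1
    edges u v uv with Fin.<-cmp u v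
    ... | tri< u<v _ _ = count-oriented u<v uv
    ... | tri≈ _ u≡v _ = contradiction u≡v (adj⇒≢ G uv)
    ... | tri> _ _ v<u = trans (count-cong (both? u v) (both? v u) (swap , swap) (map edgeSet orientedEdges))
                               (count-oriented v<u (adj-symmetric G uv))

  unionOfK1K2-or-branching : IsUnionOfK1K2 G ⊎ ∃ (Branching G)
  unionOfK1K2-or-branching
    with any? (λ w → any? λ a → any? λ b → ¬? (a ≟ b) ×-dec (adj? G w a ×-dec adj? G w b))
  ... | yes branching = inj₂ branching
  ... | no ¬branching = inj₁ λ u → Sum.map₂ (λ (v , uv) → v , uv , only uv , only (adj-symmetric G uv))
                                            (isolated-or-adjacent G u)
    where
    only : ∀ {u v} → Adj G u v → ∀ x → Adj G u x → x ≡ v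
    only {u} {v} uv x ux with x ≟ v
    ... | yes x≡v = x≡v
    ... | no x≢v  = contradiction (u , x , v , x≢v , ux , uv) ¬branching

mainTheorem9 : ∀ {n} (G : Graph n) →
    Σ ℕ λ v → Σ ℕ λ vbar → LinIntNumber G v × VBar G vbar ×
    (v ≤ vbar + n + isolatedCount G) ×
    ((v ≡ vbar + n + isolatedCount G) ⇔ IsUnionOfK1K2 G)
mainTheorem9 {n} G
  with vbar , vbar-least ← least-witness (vBarCover? G) (fromList-vBarCover G (edgeSets-vBarCover G))
  with L , refl , partition , _ ← toList-vBarCover G (proj₁ vbar-least)
  with v , v-least ← least-witness (vCover? G) (fromList-vCover G (withSingletons-vCover G partition))
  = v , length L , v-least , vbar-least , upper , mk⇔ equality⇒unionOfK1K2 unionOfK1K2⇒equality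
  where
  upper : v ≤ length L + n + isolatedCount G
  upper = subst (v ≤_) (length-withSingletons G partition)
                (proj₂ v-least _ (fromList-vCover G (withSingletons-vCover G partition)))

  equality⇒unionOfK1K2 : v ≡ length L + n + isolatedCount G → IsUnionOfK1K2 G
  equality⇒unionOfK1K2 v≡ with unionOfK1K2-or-branching G
  ... | inj₁ k1k2            = k1k2
  ... | inj₂ (w , branching) =
    let L′ , cover , shorter = strict-vCover G partition branching in
    contradiction (≤-<-trans (proj₂ v-least _ (fromList-vCover G cover))
                             (subst (length L′ <_) (sym v≡) shorter))
                  (<-irrefl refl)

  unionOfK1K2⇒equality : IsUnionOfK1K2 G → v ≡ length L + n + isolatedCount G
  unionOfK1K2⇒equality k1k2 =
    let L′ , |L′|≡v , cover = toList-vCover G (proj₁ v-least) in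
    ≤-antisym upper (subst (_ ≤_) |L′|≡v (lower-bound G k1k2 cover vbar-least))
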